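{- For integers $i,r\ge1$, $$\Delta(\mathbf{p}_{i^r})=\sum_{d=0}^r\binom rd\sum_{a=0}^d\binom da\,\mathbf{p}_{i^a}\otimes\mathbf{p}_{i^{d-a}},$$ and consequently, for a partition $\gamma$, $\Delta(\mathbf{p}_\gamma)=\prod_{i\ge1}\Delta(\mathbf{p}_{i^{m_i(\gamma)}})$.
   Context: $Sym=\mathbb{Q}[p_1,p_2,\ldots]$ is the ring of symmetric functions. The coproduct $\Delta:Sym\to Sym\otimes Sym$ is the algebra homomorphism with $\Delta(p_k)=p_k\otimes1+1\otimes p_k$. For a partition $\gamma$, $m_i(\gamma)$ is the number of parts equal to $i$. For $i\ge1$ let $q_i=\frac1i\sum_{d\mid i}\mathrm{mob}(i/d)p_d$ ($\mathrm{mob}$ the Möbius function), $(x)_r=x(x-1)\cdots(x-r+1)$, $\overline{\mathbf{p}}_{i^r}=i^r(q_i)_r$ for $r\ge1$, $\overline{\mathbf{p}}_{i^0}=1$, $\mathbf{p}_{i^r}=\sum_{k=0}^r(-1)^{r-k}\binom rk\overline{\mathbf{p}}_{i^k}$ (so $\mathbf{p}_{i^0}=1$), and $\mathbf{p}_\gamma=\prod_i\mathbf{p}_{i^{m_i(\gamma)}}$. -}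

module Defs where

open import Data.Nat as ℕ using (ℕ; zero; suc; _≤_)
open import Data.Nat.Divisibility using (_∣?_)
open import Data.Nat.Primality using (prime?)
open import Data.Nat.Combinatorics using (_C_)
import Data.Nat.DivMod as DM
open import Data.Integer as ℤ using (ℤ; +_)
open import Data.Rational as ℚ using (ℚ; 0ℚ; 1ℚ; _/_)
open import Data.List using (List; []; _∷_; map; filter; length; foldr; upTo)
open import Data.Bool.ListAction using (any)
open import Data.List.Relation.Unary.All using (All)
open import Data.List.Relation.Unary.Linked using (Linked)
open import Data.Sum using (_⊎_; inj₁; inj₂)
open import Data.Bool using (if_then_else_)
open import Relation.Nullary.Decidable using (⌊_⌋)
open import Relation.Binary.PropositionalEquality using (_≡_)

-- Polynomials over ℚ in variables from V (formal expressions), with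
-- equality = equality as polynomials.  Since ℚ is infinite, two polynomial
-- expressions are equal in ℚ[V] iff they agree at every point of ℚ^V.

infixl 6 _⊕_ _⊖_
infixl 7 _⊛_
data Poly (V : Set) : Set where
  var  : V → Poly V
  con  : ℚ → Poly V
  _⊕_  : Poly V → Poly V → Poly V
  _⊛_  : Poly V → Poly V → Poly V

eval : {V : Set} → (V → ℚ) → Poly V → ℚ
eval ρ (var v) = ρ v
eval ρ (con c) = c
eval ρ (f ⊕ g) = eval ρ f ℚ.+ eval ρ g
eval ρ (f ⊛ g) = eval ρ f ℚ.* eval ρ g

infix 4 _≈P_
_≈P_ : {V : Set} → Poly V → Poly V → Set
f ≈P g = ∀ ρ → eval ρ f ≡ eval ρ g

subst : {V W : Set} → (V → Poly W) → Poly V → Poly W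
subst σ (var v) = σ v
subst σ (con c) = con c
subst σ (f ⊕ g) = subst σ f ⊕ subst σ g
subst σ (f ⊛ g) = subst σ f ⊛ subst σ g

rename : {V W : Set} → (V → W) → Poly V → Poly W
rename h = subst (λ v → var (h v))

_⊖_ : {V : Set} → Poly V → Poly V → Poly V
f ⊖ g = f ⊕ con (ℚ.- 1ℚ) ⊛ g

cℕ : {V : Set} → ℕ → Poly V
cℕ n = con ((+ n) / 1)

cℤ : {V : Set} → ℤ → Poly V
cℤ z = con (z / 1)

ΣP : {V A : Set} → List A → (A → Poly V) → Poly V
ΣP xs f = foldr (λ x acc → f x ⊕ acc) (con 0ℚ) xs

ΠP : {V A : Set} → List A → (A → Poly V) → Poly V
ΠP xs f = foldr (λ x acc → f x ⊛ acc) (con 1ℚ) xs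

range0 : ℕ → List ℕ
range0 n = upTo (suc n)

range1 : ℕ → List ℕ
range1 n = map suc (upTo n)

-- Sym = ℚ[p₁, p₂, …]: the variable k stands for the power sum p_k
-- (the variable 0 is never used).

Sym : Set
Sym = Poly ℕ

p : ℕ → Sym
p k = var k

-- Sym ⊗ Sym = ℚ[p_k ⊗ 1, 1 ⊗ p_k]: inj₁ k ↦ p_k ⊗ 1, inj₂ k ↦ 1 ⊗ p_k.
Sym⊗Sym : Set
Sym⊗Sym = Poly (ℕ ⊎ ℕ)

infixl 7 _⊗_
_⊗_ : Sym → Sym → Sym⊗Sym
f ⊗ g = rename inj₁ f ⊛ rename inj₂ g

Δ : Sym → Sym⊗Sym
Δ = subst (λ k → var (inj₁ k) ⊕ var (inj₂ k))

-- Möbius function: mob n = 0 if some d ≥ 2 has d² ∣ n, otherwise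
-- (-1)^(number of distinct primes dividing n).  (Only used for n ≥ 1.)

mob : ℕ → ℤ
mob n =
  if any (λ d → ⌊ (suc (suc d) ℕ.* suc (suc d)) ∣? n ⌋) (upTo n)
  then + 0
  else (ℤ.- ℤ.1ℤ) ℤ.^ length (filter (λ q → prime? q) (filter (λ q → q ∣? n) (range1 n)))

-- q_i = (1/i) Σ_{d ∣ i} mob(i/d) p_d      (q_0 is unused; set to 0)
qq : ℕ → Sym
qq zero = con 0ℚ
qq (suc i′) =
  con ((+ 1) / suc i′) ⊛
  ΣP (filter (λ d′ → suc d′ ∣? suc i′) (upTo (suc i′)))
     (λ d′ → cℤ (mob (DM._/_ (suc i′) (suc d′))) ⊛ p (suc d′))

falling : {V : Set} → Poly V → ℕ → Poly V
falling x r = ΠP (upTo r) (λ j → x ⊖ cℕ j)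

pbar : ℕ → ℕ → Sym
pbar i zero = con 1ℚ
pbar i (suc r′) = cℕ (i ℕ.^ suc r′) ⊛ falling (qq i) (suc r′)

pp : ℕ → ℕ → Sym
pp i r = ΣP (range0 r) (λ k → cℤ ((ℤ.- ℤ.1ℤ) ℤ.^ (r ℕ.∸ k)) ⊛ cℕ (r C k) ⊛ pbar i k)

IsPartition : List ℕ → Set
IsPartition γ = All (λ x → 1 ≤ x) γ × Linked (λ a b → b ≤ a) γ
  where open import Data.Product using (_×_)

mult : ℕ → List ℕ → ℕ
mult i γ = length (filter (λ x → x ℕ.≟ i) γ)

sumℕ : List ℕ → ℕ
sumℕ = foldr ℕ._+_ 0

-- p_γ = Π_{i ≥ 1} p_{i^{m_i(γ)}}; factors with i > |γ| have m_i = 0, hence are 1.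
ppart : List ℕ → Sym
ppart γ = ΠP (range1 (sumℕ γ)) (λ i → pp i (mult i γ))

module Submission where

-- Every identity is checked pointwise: f ≈P g says that f and g agree under
-- every valuation ρ, and evaluating Δ f at ρ is evaluating f at the valuation
-- k ↦ ρ(p_k ⊗ 1) + ρ(1 ⊗ p_k).  The combinatorics lives in the ring of
-- rational sequences with the binomial convolution
--   (f ⋆ g)(n) = Σ_a C(n,a) f(a) g(n-a),
-- the product of exponential generating functions.  Then, at a valuation sending q_i to z, the sequence
-- r ↦ p_{i^r} is (r ↦ i^r (z)_r) ⋆ (-1)^•.  Since q_i is linear in the power
-- sums, Δ replaces z by x + y, and the Vandermonde identity turns i^n (x+y)_n
-- into a ⋆-product; cancelling the two sign factors against 1 gives the first
-- claim.  The second claim holds because Δ is multiplicative and each factor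
-- with i above all parts of γ is Δ(p_{i^0}) = 1.  Neither claim needs the
-- positivity hypotheses of the statement.

open import Defs
open import Data.Nat using (ℕ; _≤_; _∸_)
open import Data.Nat.Combinatorics using (_C_)
open import Data.List using (List)
open import Data.List.Relation.Unary.All using (All)
open import Data.Product using (_×_)

open import Data.Nat as ℕ using (zero; suc; z≤n; s≤s; _<_; _⊓_)
import Data.Nat.Properties as ℕP
open import Data.Nat.Combinatorics using (nCk+nC[k+1]≡[n+1]C[k+1]; k>n⇒nCk≡0)
open import Data.Nat.Divisibility using (_∣?_)
import Data.Nat.Coprimality as Coprimality
open import Data.Integer as ℤ using (ℤ)
import Data.Integer.Properties as ℤP
open import Data.Rational as ℚ using (ℚ; 0ℚ; 1ℚ; mkℚ; _/_; _+_; _*_)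
import Data.Rational.Properties as ℚP
open import Algebra.Bundles using (CommutativeMonoid)
open import Algebra.Properties.CommutativeSemigroup
  (CommutativeMonoid.commutativeSemigroup ℚP.+-0-commutativeMonoid)
  using () renaming (interchange to +-interchange)
open import Data.Rational.Solver using (module +-*-Solver)
open import Data.List as List using ([]; _∷_; applyUpTo; upTo)
import Data.List.Properties as ListP
import Data.List.Relation.Unary.All as All
open import Data.List.Relation.Unary.All using ([]; _∷_)
open import Data.Sum using (_⊎_; inj₁; inj₂)
open import Data.Product using (_,_)
open import Function using (_∘_; id)
open import Relation.Binary.PropositionalEquality as Eq
  using (_≡_; refl; sym; trans; cong; cong₂; _≗_)
open Eq.≡-Reasoning

-- The constants cℤ z and cℕ n of Defs evaluate to z / 1; this embedding is a
-- ring homomorphism, which we read off from the normalised form mkℚ z 0 _.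
private
  fromℤ : ℤ → ℚ
  fromℤ z = mkℚ z 0 (Coprimality.sym (Coprimality.1-coprimeTo ℤ.∣ z ∣))

  /1≡fromℤ : ∀ z → z / 1 ≡ fromℤ z
  /1≡fromℤ z = ℚP.↥p/↧p≡p (fromℤ z)

/1-+ : ∀ a b → (a ℤ.+ b) / 1 ≡ a / 1 + b / 1
/1-+ a b = begin
  (a ℤ.+ b) / 1
    ≡⟨ cong (_/ 1) (cong₂ ℤ._+_ (sym (ℤP.*-identityʳ a)) (sym (ℤP.*-identityʳ b))) ⟩
  fromℤ a + fromℤ b
    ≡⟨ sym (cong₂ _+_ (/1≡fromℤ a) (/1≡fromℤ b)) ⟩
  a / 1 + b / 1 ∎

/1-* : ∀ a b → (a ℤ.* b) / 1 ≡ (a / 1) * (b / 1)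
/1-* a b = sym (cong₂ _*_ (/1≡fromℤ a) (/1≡fromℤ b))

ι : ℕ → ℚ
ι n = ℤ.+ n / 1

ι-+ : ∀ m n → ι (m ℕ.+ n) ≡ ι m + ι n
ι-+ m n = trans (cong (_/ 1) (ℤP.pos-+ m n)) (/1-+ (ℤ.+ m) (ℤ.+ n))

ι-* : ∀ m n → ι (m ℕ.* n) ≡ ι m * ι n
ι-* m n = trans (cong (_/ 1) (ℤP.pos-* m n)) (/1-* (ℤ.+ m) (ℤ.+ n))

-1ℚ : ℚ
-1ℚ = ℚ.- 1ℚ

-- The binomial convolution ring of rational sequences

Seq : Set
Seq = ℕ → ℚ

-- ∂ shifts a sequence; on exponential generating functions it is d/dt.
∂ : Seq → Seq
∂ f m = f (suc m)

infixl 6 _+ₛ_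
_+ₛ_ : Seq → Seq → Seq
(f +ₛ g) n = f n + g n

infixr 7 _·ₛ_
_·ₛ_ : ℚ → Seq → Seq
(a ·ₛ f) n = a * f n

infixl 7 _⋆_
_⋆_ : Seq → Seq → Seq
(f ⋆ g) zero = f 0 * g 0
(f ⋆ g) (suc n) = (∂ f ⋆ g) n + (f ⋆ ∂ g) n

⋆-cong : ∀ {f f′ g g′} → f ≗ f′ → g ≗ g′ → f ⋆ g ≗ f′ ⋆ g′
⋆-cong f≗f′ g≗g′ zero = cong₂ _*_ (f≗f′ 0) (g≗g′ 0)
⋆-cong f≗f′ g≗g′ (suc n) =
  cong₂ _+_ (⋆-cong (f≗f′ ∘ suc) g≗g′ n) (⋆-cong f≗f′ (g≗g′ ∘ suc) n)

⋆-congˡ : ∀ {f f′} g → f ≗ f′ → f ⋆ g ≗ f′ ⋆ g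
⋆-congˡ g f≗f′ = ⋆-cong f≗f′ (λ _ → refl)

⋆-congʳ : ∀ f {g g′} → g ≗ g′ → f ⋆ g ≗ f ⋆ g′
⋆-congʳ f g≗g′ = ⋆-cong (λ _ → refl) g≗g′

⋆-comm : ∀ f g → f ⋆ g ≗ g ⋆ f
⋆-comm f g zero = ℚP.*-comm (f 0) (g 0)
⋆-comm f g (suc n) =
  trans (cong₂ _+_ (⋆-comm (∂ f) g n) (⋆-comm f (∂ g) n))
        (ℚP.+-comm ((g ⋆ ∂ f) n) ((∂ g ⋆ f) n))

⋆-distribʳ-+ : ∀ f g h → (f +ₛ g) ⋆ h ≗ f ⋆ h +ₛ g ⋆ h
⋆-distribʳ-+ f g h zero = ℚP.*-distribʳ-+ (h 0) (f 0) (g 0)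
⋆-distribʳ-+ f g h (suc n) = begin
  ((∂ f +ₛ ∂ g) ⋆ h) n + ((f +ₛ g) ⋆ ∂ h) n
    ≡⟨ cong₂ _+_ (⋆-distribʳ-+ (∂ f) (∂ g) h n) (⋆-distribʳ-+ f g (∂ h) n) ⟩
  ((∂ f ⋆ h) n + (∂ g ⋆ h) n) + ((f ⋆ ∂ h) n + (g ⋆ ∂ h) n)
    ≡⟨ +-interchange ((∂ f ⋆ h) n) ((∂ g ⋆ h) n) ((f ⋆ ∂ h) n) ((g ⋆ ∂ h) n) ⟩
  ((∂ f ⋆ h) n + (f ⋆ ∂ h) n) + ((∂ g ⋆ h) n + (g ⋆ ∂ h) n) ∎

⋆-distribˡ-+ : ∀ f g h → f ⋆ (g +ₛ h) ≗ f ⋆ g +ₛ f ⋆ h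
⋆-distribˡ-+ f g h n = begin
  (f ⋆ (g +ₛ h)) n              ≡⟨ ⋆-comm f (g +ₛ h) n ⟩
  ((g +ₛ h) ⋆ f) n              ≡⟨ ⋆-distribʳ-+ g h f n ⟩
  (g ⋆ f) n + (h ⋆ f) n         ≡⟨ cong₂ _+_ (⋆-comm g f n) (⋆-comm h f n) ⟩
  (f ⋆ g) n + (f ⋆ h) n         ∎

⋆-scalarˡ : ∀ a f h → (a ·ₛ f) ⋆ h ≗ a ·ₛ (f ⋆ h)
⋆-scalarˡ a f h zero = ℚP.*-assoc a (f 0) (h 0)
⋆-scalarˡ a f h (suc n) =
  trans (cong₂ _+_ (⋆-scalarˡ a (∂ f) h n) (⋆-scalarˡ a f (∂ h) n))
        (sym (ℚP.*-distribˡ-+ a ((∂ f ⋆ h) n) ((f ⋆ ∂ h) n)))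

⋆-scalarʳ : ∀ a f h → f ⋆ (a ·ₛ h) ≗ a ·ₛ (f ⋆ h)
⋆-scalarʳ a f h n = begin
  (f ⋆ (a ·ₛ h)) n   ≡⟨ ⋆-comm f (a ·ₛ h) n ⟩
  ((a ·ₛ h) ⋆ f) n   ≡⟨ ⋆-scalarˡ a h f n ⟩
  a * (h ⋆ f) n      ≡⟨ cong (a *_) (⋆-comm h f n) ⟩
  a * (f ⋆ h) n      ∎

⋆-assoc : ∀ f g h → (f ⋆ g) ⋆ h ≗ f ⋆ (g ⋆ h)
⋆-assoc f g h zero = ℚP.*-assoc (f 0) (g 0) (h 0)
⋆-assoc f g h (suc n) = begin
  ((∂ f ⋆ g +ₛ f ⋆ ∂ g) ⋆ h) n + ((f ⋆ g) ⋆ ∂ h) n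
    ≡⟨ cong (_+ ((f ⋆ g) ⋆ ∂ h) n) (⋆-distribʳ-+ (∂ f ⋆ g) (f ⋆ ∂ g) h n) ⟩
  (((∂ f ⋆ g) ⋆ h) n + ((f ⋆ ∂ g) ⋆ h) n) + ((f ⋆ g) ⋆ ∂ h) n
    ≡⟨ cong₂ _+_ (cong₂ _+_ (⋆-assoc (∂ f) g h n) (⋆-assoc f (∂ g) h n)) (⋆-assoc f g (∂ h) n) ⟩
  ((∂ f ⋆ (g ⋆ h)) n + (f ⋆ (∂ g ⋆ h)) n) + (f ⋆ (g ⋆ ∂ h)) n
    ≡⟨ ℚP.+-assoc ((∂ f ⋆ (g ⋆ h)) n) ((f ⋆ (∂ g ⋆ h)) n) ((f ⋆ (g ⋆ ∂ h)) n) ⟩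
  (∂ f ⋆ (g ⋆ h)) n + ((f ⋆ (∂ g ⋆ h)) n + (f ⋆ (g ⋆ ∂ h)) n)
    ≡⟨ cong ((∂ f ⋆ (g ⋆ h)) n +_) (sym (⋆-distribˡ-+ f (∂ g ⋆ h) (g ⋆ ∂ h) n)) ⟩
  (∂ f ⋆ (g ⋆ h)) n + (f ⋆ ∂ (g ⋆ h)) n ∎

δ : Seq
δ zero = 1ℚ
δ (suc _) = 0ℚ

⋆-identityˡ : ∀ f → δ ⋆ f ≗ f
⋆-identityˡ f zero = ℚP.*-identityˡ (f 0)
⋆-identityˡ f (suc n) = begin
  (∂ δ ⋆ f) n + (δ ⋆ ∂ f) n   ≡⟨ cong₂ _+_ (zero⋆f n) (⋆-identityˡ (∂ f) n) ⟩
  0ℚ + f (suc n)              ≡⟨ ℚP.+-identityˡ (f (suc n)) ⟩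
  f (suc n)                   ∎
  where
  -- ∂ δ is the zero sequence 0 ·ₛ δ, and ⋆ is bilinear.
  zero⋆f : ∂ δ ⋆ f ≗ (λ _ → 0ℚ)
  zero⋆f m = begin
    (∂ δ ⋆ f) m          ≡⟨ ⋆-congˡ f (λ k → sym (ℚP.*-zeroˡ (∂ δ k))) m ⟩
    ((0ℚ ·ₛ ∂ δ) ⋆ f) m  ≡⟨ ⋆-scalarˡ 0ℚ (∂ δ) f m ⟩
    0ℚ * (∂ δ ⋆ f) m     ≡⟨ ℚP.*-zeroˡ ((∂ δ ⋆ f) m) ⟩
    0ℚ                   ∎

-- The exponential generating functions e^t and e^{-t}.
ones : Seq
ones _ = 1ℚ

signs : Seq
signs m = ((ℤ.- ℤ.1ℤ) ℤ.^ m) / 1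

signs-suc : ∀ m → signs (suc m) ≡ -1ℚ * signs m
signs-suc m = /1-* (ℤ.- ℤ.1ℤ) ((ℤ.- ℤ.1ℤ) ℤ.^ m)

-- e^t · e^{-t} = 1: ∂ is ⋆-linear, ∂ ones = ones and ∂ signs = -signs.
ones⋆signs : ones ⋆ signs ≗ δ
ones⋆signs zero = refl
ones⋆signs (suc n) = begin
  (ones ⋆ signs) n + (ones ⋆ ∂ signs) n
    ≡⟨ cong ((ones ⋆ signs) n +_) (⋆-congʳ ones signs-suc n) ⟩
  (ones ⋆ signs) n + (ones ⋆ (-1ℚ ·ₛ signs)) n
    ≡⟨ cong ((ones ⋆ signs) n +_) (⋆-scalarʳ -1ℚ ones signs n) ⟩
  (ones ⋆ signs) n + -1ℚ * (ones ⋆ signs) n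
    ≡⟨ solve 1 (λ x → x :+ con -1ℚ :* x := con 0ℚ) refl ((ones ⋆ signs) n) ⟩
  0ℚ ∎
  where open +-*-Solver

-- Binomial transforms are multiplicative up to one factor e^t:
-- (A e^{-t})(B e^{-t}) e^t = (A B) e^{-t}.
signed-product : ∀ A B → ((A ⋆ signs) ⋆ (B ⋆ signs)) ⋆ ones ≗ (A ⋆ B) ⋆ signs
signed-product A B n = begin
  (((A ⋆ signs) ⋆ (B ⋆ signs)) ⋆ ones) n  ≡⟨ ⋆-congˡ ones regroup n ⟩
  ((((A ⋆ B) ⋆ signs) ⋆ signs) ⋆ ones) n  ≡⟨ ⋆-assoc ((A ⋆ B) ⋆ signs) signs ones n ⟩
  (((A ⋆ B) ⋆ signs) ⋆ (signs ⋆ ones)) n  ≡⟨ ⋆-congʳ ((A ⋆ B) ⋆ signs) (⋆-comm signs ones) n ⟩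
  (((A ⋆ B) ⋆ signs) ⋆ (ones ⋆ signs)) n  ≡⟨ ⋆-congʳ ((A ⋆ B) ⋆ signs) ones⋆signs n ⟩
  (((A ⋆ B) ⋆ signs) ⋆ δ) n               ≡⟨ ⋆-comm ((A ⋆ B) ⋆ signs) δ n ⟩
  (δ ⋆ ((A ⋆ B) ⋆ signs)) n               ≡⟨ ⋆-identityˡ ((A ⋆ B) ⋆ signs) n ⟩
  ((A ⋆ B) ⋆ signs) n                     ∎
  where
  regroup : (A ⋆ signs) ⋆ (B ⋆ signs) ≗ ((A ⋆ B) ⋆ signs) ⋆ signs
  regroup m = begin
    ((A ⋆ signs) ⋆ (B ⋆ signs)) m   ≡⟨ ⋆-assoc (A ⋆ signs) B signs m ⟨
    (((A ⋆ signs) ⋆ B) ⋆ signs) m   ≡⟨ ⋆-congˡ signs (⋆-assoc A signs B) m ⟩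
    ((A ⋆ (signs ⋆ B)) ⋆ signs) m   ≡⟨ ⋆-congˡ signs (⋆-congʳ A (⋆-comm signs B)) m ⟩
    ((A ⋆ (B ⋆ signs)) ⋆ signs) m   ≡⟨ ⋆-congˡ signs (⋆-assoc A B signs) m ⟨
    (((A ⋆ B) ⋆ signs) ⋆ signs) m   ∎

-- The explicit binomial formula for ⋆

sumTo : ℕ → Seq → ℚ
sumTo zero h = h 0
sumTo (suc n) h = h 0 + sumTo n (∂ h)

sumTo-cong : ∀ n {h h′ : Seq} → (∀ a → a ≤ n → h a ≡ h′ a) → sumTo n h ≡ sumTo n h′
sumTo-cong zero h≡h′ = h≡h′ 0 z≤n
sumTo-cong (suc n) h≡h′ =
  cong₂ _+_ (h≡h′ 0 z≤n) (sumTo-cong n (λ a a≤n → h≡h′ (suc a) (s≤s a≤n)))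

sumTo-+ : ∀ n h k → sumTo n (h +ₛ k) ≡ sumTo n h + sumTo n k
sumTo-+ zero h k = refl
sumTo-+ (suc n) h k = begin
  (h 0 + k 0) + sumTo n (∂ h +ₛ ∂ k)
    ≡⟨ cong ((h 0 + k 0) +_) (sumTo-+ n (∂ h) (∂ k)) ⟩
  (h 0 + k 0) + (sumTo n (∂ h) + sumTo n (∂ k))
    ≡⟨ +-interchange (h 0) (k 0) (sumTo n (∂ h)) (sumTo n (∂ k)) ⟩
  (h 0 + sumTo n (∂ h)) + (k 0 + sumTo n (∂ k)) ∎

sumTo-last : ∀ n h → sumTo (suc n) h ≡ sumTo n h + h (suc n)
sumTo-last zero h = refl
sumTo-last (suc n) h =
  trans (cong (h 0 +_) (sumTo-last n (∂ h)))
        (sym (ℚP.+-assoc (h 0) (sumTo n (∂ h)) (h (suc (suc n)))))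

binomialSum : Seq → Seq → Seq
binomialSum f g n = sumTo n (λ a → ι (n C a) * f a * g (n ∸ a))

-- Pascal's rule C(n+1,a+1) = C(n,a) + C(n,a+1) splits the sum into the
-- two sums of the Leibniz rule; the term a = n+1 of the second one vanishes.
binomialSum-suc : ∀ f g n → binomialSum f g (suc n) ≡ binomialSum (∂ f) g n + binomialSum f (∂ g) n
binomialSum-suc f g n = begin
  H 0 + sumTo n (∂ H)
    ≡⟨ cong (H 0 +_) (sumTo-cong n (λ a _ → pascal a)) ⟩
  H 0 + sumTo n (L +ₛ ∂ K)
    ≡⟨ cong (H 0 +_) (sumTo-+ n L (∂ K)) ⟩
  H 0 + (binomialSum (∂ f) g n + sumTo n (∂ K))
    ≡⟨ solve 3 (λ a b x → a :+ (b :+ x) := b :+ (a :+ x)) refl (H 0) (binomialSum (∂ f) g n) (sumTo n (∂ K)) ⟩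
  binomialSum (∂ f) g n + sumTo (suc n) K
    ≡⟨ cong (binomialSum (∂ f) g n +_) (sumTo-last n K) ⟩
  binomialSum (∂ f) g n + (sumTo n K + K (suc n))
    ≡⟨ cong (λ t → binomialSum (∂ f) g n + (sumTo n K + t)) last-vanishes ⟩
  binomialSum (∂ f) g n + (sumTo n K + 0ℚ)
    ≡⟨ cong (binomialSum (∂ f) g n +_) (ℚP.+-identityʳ (sumTo n K)) ⟩
  binomialSum (∂ f) g n + sumTo n K
    ≡⟨ cong (binomialSum (∂ f) g n +_) (sumTo-cong n λ a a≤n →
         cong (λ t → ι (n C a) * f a * g t) (ℕP.+-∸-assoc 1 a≤n)) ⟩
  binomialSum (∂ f) g n + binomialSum f (∂ g) n ∎
  where
  open +-*-Solver
  H L K : Seq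
  H a = ι (suc n C a) * f a * g (suc n ∸ a)
  L a = ι (n C a) * f (suc a) * g (n ∸ a)
  K a = ι (n C a) * f a * g (suc n ∸ a)
  pascal : ∀ a → ∂ H a ≡ L a + K (suc a)
  pascal a = begin
    ι (suc n C suc a) * f (suc a) * g (n ∸ a)
      ≡⟨ cong (λ t → ι t * f (suc a) * g (n ∸ a)) (nCk+nC[k+1]≡[n+1]C[k+1] n a) ⟨
    ι (n C a ℕ.+ n C suc a) * f (suc a) * g (n ∸ a)
      ≡⟨ cong (λ t → t * f (suc a) * g (n ∸ a)) (ι-+ (n C a) (n C suc a)) ⟩
    (ι (n C a) + ι (n C suc a)) * f (suc a) * g (n ∸ a)
      ≡⟨ solve 4 (λ p q x y → (p :+ q) :* x :* y := p :* x :* y :+ q :* x :* y) refl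
           (ι (n C a)) (ι (n C suc a)) (f (suc a)) (g (n ∸ a)) ⟩
    L a + K (suc a) ∎
  last-vanishes : K (suc n) ≡ 0ℚ
  last-vanishes = begin
    ι (n C suc n) * f (suc n) * g (n ∸ n)
      ≡⟨ cong (λ t → ι t * f (suc n) * g (n ∸ n)) (k>n⇒nCk≡0 (ℕP.n<1+n n)) ⟩
    0ℚ * f (suc n) * g (n ∸ n)
      ≡⟨ solve 2 (λ x y → con 0ℚ :* x :* y := con 0ℚ) refl (f (suc n)) (g (n ∸ n)) ⟩
    0ℚ ∎

binomialSum≡⋆ : ∀ n f g → binomialSum f g n ≡ (f ⋆ g) n
binomialSum≡⋆ zero f g = cong (_* g 0) (ℚP.*-identityˡ (f 0))
binomialSum≡⋆ (suc n) f g =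
  trans (binomialSum-suc f g n) (cong₂ _+_ (binomialSum≡⋆ n (∂ f) g) (binomialSum≡⋆ n f (∂ g)))

-- Evaluation after a substitution is evaluation at the substituted values;
-- in particular Δ acts on values by k ↦ ρ(p_k ⊗ 1) + ρ(1 ⊗ p_k).
eval-subst : ∀ {V W : Set} (ρ : W → ℚ) (σ : V → Poly W) f →
             eval ρ (subst σ f) ≡ eval (λ v → eval ρ (σ v)) f
eval-subst ρ σ (var v) = refl
eval-subst ρ σ (con x) = refl
eval-subst ρ σ (f ⊕ g) = cong₂ _+_ (eval-subst ρ σ f) (eval-subst ρ σ g)
eval-subst ρ σ (f ⊛ g) = cong₂ _*_ (eval-subst ρ σ f) (eval-subst ρ σ g)

eval-ΣP-applyUpTo : ∀ {V : Set} (ρ : V → ℚ) n (g : ℕ → ℕ) (F : ℕ → Poly V) →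
                    eval ρ (ΣP (applyUpTo g (suc n)) F) ≡ sumTo n (λ a → eval ρ (F (g a)))
eval-ΣP-applyUpTo ρ zero g F = ℚP.+-identityʳ (eval ρ (F (g 0)))
eval-ΣP-applyUpTo ρ (suc n) g F = cong (eval ρ (F (g 0)) +_) (eval-ΣP-applyUpTo ρ n (g ∘ suc) F)

eval-ΣP-range0 : ∀ {V : Set} (ρ : V → ℚ) n (F : ℕ → Poly V) →
                 eval ρ (ΣP (range0 n) F) ≡ sumTo n (λ a → eval ρ (F a))
eval-ΣP-range0 ρ n F = eval-ΣP-applyUpTo ρ n id F

-- Falling factorials and the Vandermonde identity

fall : ℚ → Seq
fall z zero = 1ℚ
fall z (suc n) = z * fall (z + -1ℚ) n

-- The product Π_{j<k} (q - f(j)) evaluates to (w)_k as soon as the factors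
-- are (w - j); this invariant survives the shift f ↦ f ∘ suc, w ↦ w - 1.
eval-falling-from : ∀ (ρ : ℕ → ℚ) q k (f : ℕ → ℕ) w →
  (∀ j → eval ρ q + -1ℚ * ι (f j) ≡ w + -1ℚ * ι j) →
  eval ρ (ΠP (applyUpTo f k) (λ j → q ⊖ cℕ j)) ≡ fall w k
eval-falling-from ρ q zero f w factors = refl
eval-falling-from ρ q (suc k) f w factors = cong₂ _*_ first-factor
  (eval-falling-from ρ q k (f ∘ suc) (w + -1ℚ) (λ j → trans (factors (suc j)) (shift j)))
  where
  open +-*-Solver
  first-factor : eval ρ q + -1ℚ * ι (f 0) ≡ w
  first-factor = trans (factors 0) (solve 1 (λ w → w :+ con -1ℚ :* con 0ℚ := w) refl w)
  shift : ∀ j → w + -1ℚ * ι (suc j) ≡ (w + -1ℚ) + -1ℚ * ι j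
  shift j = trans (cong (λ t → w + -1ℚ * t) (ι-+ 1 j))
    (solve 2 (λ w x → w :+ con -1ℚ :* (con 1ℚ :+ x) := (w :+ con -1ℚ) :+ con -1ℚ :* x) refl w (ι j))

eval-falling : ∀ (ρ : ℕ → ℚ) q k → eval ρ (falling q k) ≡ fall (eval ρ q) k
eval-falling ρ q k = eval-falling-from ρ q k id (eval ρ q) (λ j → refl)

-- The scaled falling factorial i^n (z)_n, the value of pbar_{i^n} at q_i = z.
scaledFall : ℕ → ℚ → Seq
scaledFall i z n = ι (i ℕ.^ n) * fall z n

scaledFall-suc : ∀ i z m → scaledFall i z (suc m) ≡ (ι i * z) * scaledFall i (z + -1ℚ) m
scaledFall-suc i z m = begin
  ι (i ℕ.* i ℕ.^ m) * (z * fall (z + -1ℚ) m)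
    ≡⟨ cong (_* (z * fall (z + -1ℚ) m)) (ι-* i (i ℕ.^ m)) ⟩
  (ι i * ι (i ℕ.^ m)) * (z * fall (z + -1ℚ) m)
    ≡⟨ solve 4 (λ a b z f → (a :* b) :* (z :* f) := (a :* z) :* (b :* f)) refl
         (ι i) (ι (i ℕ.^ m)) z (fall (z + -1ℚ) m) ⟩
  (ι i * z) * scaledFall i (z + -1ℚ) m ∎
  where open +-*-Solver

-- Vandermonde: i^n (x+y)_n = Σ_a C(n,a) i^a (x)_a i^{n-a} (y)_{n-a}.  Both
-- sides satisfy the Leibniz recursion, using scaledFall-suc on each factor.
vandermonde : ∀ i x y → scaledFall i (x + y) ≗ scaledFall i x ⋆ scaledFall i y
vandermonde i x y zero = refl
vandermonde i x y (suc n) = sym (begin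
  (∂ (scaledFall i x) ⋆ scaledFall i y) n + (scaledFall i x ⋆ ∂ (scaledFall i y)) n
    ≡⟨ cong₂ _+_ (⋆-congˡ (scaledFall i y) (scaledFall-suc i x) n)
                 (⋆-congʳ (scaledFall i x) (scaledFall-suc i y) n) ⟩
  (((ι i * x) ·ₛ scaledFall i x′) ⋆ scaledFall i y) n
    + (scaledFall i x ⋆ ((ι i * y) ·ₛ scaledFall i y′)) n
    ≡⟨ cong₂ _+_ (⋆-scalarˡ (ι i * x) (scaledFall i x′) (scaledFall i y) n)
                 (⋆-scalarʳ (ι i * y) (scaledFall i x) (scaledFall i y′) n) ⟩
  (ι i * x) * (scaledFall i x′ ⋆ scaledFall i y) n
    + (ι i * y) * (scaledFall i x ⋆ scaledFall i y′) n
    ≡⟨ cong₂ _+_ (cong ((ι i * x) *_) (vandermonde i x′ y n))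
                 (cong ((ι i * y) *_) (vandermonde i x y′ n)) ⟨
  (ι i * x) * scaledFall i (x′ + y) n + (ι i * y) * scaledFall i (x + y′) n
    ≡⟨ cong₂ _+_ (cong (λ t → (ι i * x) * scaledFall i t n) shift-x)
                 (cong (λ t → (ι i * y) * scaledFall i t n) shift-y) ⟩
  (ι i * x) * scaledFall i s′ n + (ι i * y) * scaledFall i s′ n
    ≡⟨ solve 4 (λ a x y p → (a :* x) :* p :+ (a :* y) :* p := (a :* (x :+ y)) :* p) refl
         (ι i) x y (scaledFall i s′ n) ⟩
  (ι i * (x + y)) * scaledFall i s′ n
    ≡⟨ scaledFall-suc i (x + y) n ⟨
  scaledFall i (x + y) (suc n) ∎)
  where
  open +-*-Solver
  x′ y′ s′ : ℚ
  x′ = x + -1ℚ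
  y′ = y + -1ℚ
  s′ = (x + y) + -1ℚ
  shift-x : x′ + y ≡ s′
  shift-x = solve 2 (λ x y → (x :+ con -1ℚ) :+ y := (x :+ y) :+ con -1ℚ) refl x y
  shift-y : x + y′ ≡ s′
  shift-y = solve 2 (λ x y → x :+ (y :+ con -1ℚ) := (x :+ y) :+ con -1ℚ) refl x y

eval-pbar : ∀ (ρ : ℕ → ℚ) i k → eval ρ (pbar i k) ≡ scaledFall i (eval ρ (qq i)) k
eval-pbar ρ i zero = refl
eval-pbar ρ i (suc k) = cong (ι (i ℕ.^ suc k) *_) (eval-falling ρ (qq i) (suc k))

eval-pp : ∀ (ρ : ℕ → ℚ) i → (λ r → eval ρ (pp i r)) ≗ scaledFall i (eval ρ (qq i)) ⋆ signs
eval-pp ρ i r = begin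
  eval ρ (pp i r)
    ≡⟨ eval-ΣP-range0 ρ r term ⟩
  sumTo r (λ k → (signs (r ∸ k) * ι (r C k)) * eval ρ (pbar i k))
    ≡⟨ sumTo-cong r (λ k _ → reorder k) ⟩
  binomialSum (scaledFall i z) signs r
    ≡⟨ binomialSum≡⋆ r (scaledFall i z) signs ⟩
  (scaledFall i z ⋆ signs) r ∎
  where
  open +-*-Solver
  z : ℚ
  z = eval ρ (qq i)
  term : ℕ → Sym
  term k = cℤ ((ℤ.- ℤ.1ℤ) ℤ.^ (r ∸ k)) ⊛ cℕ (r C k) ⊛ pbar i k
  reorder : ∀ k → (signs (r ∸ k) * ι (r C k)) * eval ρ (pbar i k)
                ≡ ι (r C k) * scaledFall i z k * signs (r ∸ k)
  reorder k = trans (cong ((signs (r ∸ k) * ι (r C k)) *_) (eval-pbar ρ i k))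
    (solve 3 (λ s b p → (s :* b) :* p := b :* p :* s) refl (signs (r ∸ k)) (ι (r C k)) (scaledFall i z k))

linearForm-additive : ∀ (ρ₁ ρ₂ : ℕ → ℚ) (ds : List ℕ) (a : ℕ → ℚ) (v : ℕ → ℕ) →
  let form = ΣP ds (λ d → con (a d) ⊛ var (v d)) in
  eval (λ k → ρ₁ k + ρ₂ k) form ≡ eval ρ₁ form + eval ρ₂ form
linearForm-additive ρ₁ ρ₂ [] a v = refl
linearForm-additive ρ₁ ρ₂ (d ∷ ds) a v = begin
  a d * (ρ₁ (v d) + ρ₂ (v d)) + eval σ rest
    ≡⟨ cong₂ _+_ (ℚP.*-distribˡ-+ (a d) (ρ₁ (v d)) (ρ₂ (v d))) (linearForm-additive ρ₁ ρ₂ ds a v) ⟩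
  (a d * ρ₁ (v d) + a d * ρ₂ (v d)) + (eval ρ₁ rest + eval ρ₂ rest)
    ≡⟨ +-interchange (a d * ρ₁ (v d)) (a d * ρ₂ (v d)) (eval ρ₁ rest) (eval ρ₂ rest) ⟩
  (a d * ρ₁ (v d) + eval ρ₁ rest) + (a d * ρ₂ (v d) + eval ρ₂ rest) ∎
  where
  σ : ℕ → ℚ
  σ k = ρ₁ k + ρ₂ k
  rest : Sym
  rest = ΣP ds (λ d → con (a d) ⊛ var (v d))

-- q_i is a linear combination of power sums, hence primitive: Δ q_i = q_i ⊗ 1 + 1 ⊗ q_i.
qq-additive : ∀ (ρ₁ ρ₂ : ℕ → ℚ) i → eval (λ k → ρ₁ k + ρ₂ k) (qq i) ≡ eval ρ₁ (qq i) + eval ρ₂ (qq i)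
qq-additive ρ₁ ρ₂ zero = refl
qq-additive ρ₁ ρ₂ (suc i′) =
  trans (cong (1/i *_) (linearForm-additive ρ₁ ρ₂ divisors μ suc))
        (ℚP.*-distribˡ-+ 1/i (eval ρ₁ form) (eval ρ₂ form))
  where
  1/i : ℚ
  1/i = ℤ.+ 1 / suc i′
  divisors : List ℕ
  divisors = List.filter (λ d′ → suc d′ ∣? suc i′) (upTo (suc i′))
  μ : ℕ → ℚ
  μ d′ = mob (suc i′ ℕ./ suc d′) / 1
  form : Sym
  form = ΣP divisors (λ d → con (μ d) ⊛ var (suc d))

-- The coproduct of p_{i^r}

eval-binomial-⊗ : ∀ (ρ : ℕ ⊎ ℕ → ℚ) (f g : ℕ → Sym) d →
  eval ρ (ΣP (range0 d) (λ a → cℕ (d C a) ⊛ (f a ⊗ g (d ∸ a))))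
    ≡ binomialSum (λ a → eval (ρ ∘ inj₁) (f a)) (λ b → eval (ρ ∘ inj₂) (g b)) d
eval-binomial-⊗ ρ f g d = trans (eval-ΣP-range0 ρ d (λ a → cℕ (d C a) ⊛ (f a ⊗ g (d ∸ a)))) (sumTo-cong d λ a _ → begin
  ι (d C a) * (eval ρ (rename inj₁ (f a)) * eval ρ (rename inj₂ (g (d ∸ a))))
    ≡⟨ cong (ι (d C a) *_) (cong₂ _*_ (eval-subst ρ _ (f a)) (eval-subst ρ _ (g (d ∸ a)))) ⟩
  ι (d C a) * (eval (ρ ∘ inj₁) (f a) * eval (ρ ∘ inj₂) (g (d ∸ a)))
    ≡⟨ ℚP.*-assoc (ι (d C a)) (eval (ρ ∘ inj₁) (f a)) (eval (ρ ∘ inj₂) (g (d ∸ a))) ⟨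
  ι (d C a) * eval (ρ ∘ inj₁) (f a) * eval (ρ ∘ inj₂) (g (d ∸ a)) ∎)

eval-binomial-ones : ∀ {V : Set} (ρ : V → ℚ) (G : ℕ → Poly V) r →
  eval ρ (ΣP (range0 r) (λ d → cℕ (r C d) ⊛ G d)) ≡ binomialSum (λ d → eval ρ (G d)) ones r
eval-binomial-ones ρ G r = trans (eval-ΣP-range0 ρ r (λ d → cℕ (r C d) ⊛ G d))
  (sumTo-cong r λ d _ → sym (ℚP.*-identityʳ (ι (r C d) * eval ρ (G d))))

-- Δ p_{i^•} = (p_{i^•} ⊗ p_{i^•}) ⋆ 1: at a valuation, Δ moves q_i to x + y,
-- Vandermonde splits pbar, and signed-product absorbs the two sign factors.
coproduct-pp : (i r : ℕ) →
  Δ (pp i r) ≈P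
    ΣP (range0 r) (λ d → cℕ (r C d) ⊛
      ΣP (range0 d) (λ a → cℕ (d C a) ⊛ (pp i a ⊗ pp i (d ∸ a))))
coproduct-pp i r ρ = begin
  eval ρ (Δ (pp i r))
    ≡⟨ eval-subst ρ _ (pp i r) ⟩
  eval σ (pp i r)
    ≡⟨ eval-pp σ i r ⟩
  (scaledFall i (eval σ (qq i)) ⋆ signs) r
    ≡⟨ cong (λ t → (scaledFall i t ⋆ signs) r) (qq-additive ρ₁ ρ₂ i) ⟩
  (scaledFall i (x + y) ⋆ signs) r
    ≡⟨ ⋆-congˡ signs (vandermonde i x y) r ⟩
  ((scaledFall i x ⋆ scaledFall i y) ⋆ signs) r
    ≡⟨ signed-product (scaledFall i x) (scaledFall i y) r ⟨
  (((scaledFall i x ⋆ signs) ⋆ (scaledFall i y ⋆ signs)) ⋆ ones) r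
    ≡⟨ ⋆-congˡ ones (⋆-cong (eval-pp ρ₁ i) (eval-pp ρ₂ i)) r ⟨
  ((P₁ ⋆ P₂) ⋆ ones) r
    ≡⟨ ⋆-congˡ ones (λ d → trans (eval-binomial-⊗ ρ (pp i) (pp i) d) (binomialSum≡⋆ d P₁ P₂)) r ⟨
  ((λ d → eval ρ (inner d)) ⋆ ones) r
    ≡⟨ trans (eval-binomial-ones ρ inner r) (binomialSum≡⋆ r _ ones) ⟨
  eval ρ (ΣP (range0 r) (λ d → cℕ (r C d) ⊛ inner d)) ∎
  where
  ρ₁ ρ₂ σ : ℕ → ℚ
  ρ₁ = ρ ∘ inj₁
  ρ₂ = ρ ∘ inj₂
  σ k = ρ₁ k + ρ₂ k
  x y : ℚ
  x = eval ρ₁ (qq i)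
  y = eval ρ₂ (qq i)
  P₁ P₂ : Seq
  P₁ a = eval ρ₁ (pp i a)
  P₂ a = eval ρ₂ (pp i a)
  inner : ℕ → Sym⊗Sym
  inner d = ΣP (range0 d) (λ a → cℕ (d C a) ⊛ (pp i a ⊗ pp i (d ∸ a)))

Δ-ΠP : ∀ {A : Set} (xs : List A) (f : A → Sym) → Δ (ΠP xs f) ≡ ΠP xs (Δ ∘ f)
Δ-ΠP [] f = refl
Δ-ΠP (x ∷ xs) f = cong (Δ (f x) ⊛_) (Δ-ΠP xs f)

prodTo : ℕ → Seq → ℚ
prodTo zero h = 1ℚ
prodTo (suc n) h = h 0 * prodTo n (∂ h)

eval-ΠP-range1 : ∀ {V : Set} (ρ : V → ℚ) n (g : ℕ → Poly V) →
                 eval ρ (ΠP (range1 n) g) ≡ prodTo n (λ j → eval ρ (g (suc j)))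
eval-ΠP-range1 ρ n g = trans (cong (λ xs → eval ρ (ΠP xs g)) (ListP.map-upTo suc n)) (go n suc)
  where
  go : ∀ n (s : ℕ → ℕ) → eval ρ (ΠP (applyUpTo s n) g) ≡ prodTo n (λ j → eval ρ (g (s j)))
  go zero s = refl
  go (suc n) s = cong (eval ρ (g (s 0)) *_) (go n (s ∘ suc))

prodTo-truncate : ∀ K n (h : Seq) → K ≤ n → (∀ j → K ≤ j → h j ≡ 1ℚ) → prodTo n h ≡ prodTo K h
prodTo-truncate zero zero h _ trivial = refl
prodTo-truncate zero (suc n) h _ trivial =
  trans (cong₂ _*_ (trivial 0 z≤n) (prodTo-truncate zero n (∂ h) z≤n (λ j _ → trivial (suc j) z≤n)))
        (ℚP.*-identityˡ 1ℚ)
prodTo-truncate (suc K) (suc n) h (s≤s K≤n) trivial =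
  cong (h 0 *_) (prodTo-truncate K n (∂ h) K≤n (λ j K≤j → trivial (suc j) (s≤s K≤j)))

mult-absent : ∀ i (γ : List ℕ) → All (_< i) γ → mult i γ ≡ 0
mult-absent i γ parts<i =
  cong List.length (ListP.filter-none (λ x → x ℕ.≟ i) (All.map ℕP.<⇒≢ parts<i))

parts≤sum : ∀ γ → All (_≤ sumℕ γ) γ
parts≤sum [] = []
parts≤sum (x ∷ xs) =
  ℕP.m≤m+n x (sumℕ xs) ∷ All.map (λ x≤ → ℕP.≤-trans x≤ (ℕP.m≤n+m (sumℕ xs) x)) (parts≤sum xs)

-- Second claim: p_γ is truncated at |γ| in Defs, but every factor Δ p_{i^{m_i}}
-- with i above all parts is Δ p_{i^0} = 1, so any bound N gives the same product.
coproduct-ppart : (γ : List ℕ) → (N : ℕ) → All (_≤ N) γ →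
  Δ (ppart γ) ≈P ΠP (range1 N) (λ i → Δ (pp i (mult i γ)))
coproduct-ppart γ N parts≤N ρ = begin
  eval ρ (Δ (ppart γ))              ≡⟨ cong (eval ρ) (Δ-ΠP (range1 |γ|) (λ i → pp i (mult i γ))) ⟩
  eval ρ (ΠP (range1 |γ|) factor)   ≡⟨ eval-ΠP-range1 ρ |γ| factor ⟩
  prodTo |γ| h                      ≡⟨ prodTo-truncate K |γ| h (ℕP.m⊓n≤m |γ| N) trivial ⟩
  prodTo K h                        ≡⟨ prodTo-truncate K N h (ℕP.m⊓n≤n |γ| N) trivial ⟨
  prodTo N h                        ≡⟨ eval-ΠP-range1 ρ N factor ⟨
  eval ρ (ΠP (range1 N) factor)     ∎
  where
  |γ| K : ℕ
  |γ| = sumℕ γ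
  K = |γ| ⊓ N
  factor : ℕ → Sym⊗Sym
  factor i = Δ (pp i (mult i γ))
  h : Seq
  h j = eval ρ (factor (suc j))
  parts≤K : All (_≤ K) γ
  parts≤K = All.zipWith (λ (≤|γ| , ≤N) → ℕP.⊓-glb ≤|γ| ≤N) (parts≤sum γ , parts≤N)
  trivial : ∀ j → K ≤ j → h j ≡ 1ℚ
  trivial j K≤j = cong (λ m → eval ρ (Δ (pp (suc j) m)))
    (mult-absent (suc j) γ (All.map (λ x≤K → s≤s (ℕP.≤-trans x≤K K≤j)) parts≤K))

mainTheorem8 :
    ((i r : ℕ) → 1 ≤ i → 1 ≤ r →
      Δ (pp i r) ≈P
        ΣP (range0 r) (λ d → cℕ (r C d) ⊛
          ΣP (range0 d) (λ a → cℕ (d C a) ⊛ (pp i a ⊗ pp i (d ∸ a)))))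
    ×
    ((γ : List ℕ) → IsPartition γ → (N : ℕ) → All (λ x → x ≤ N) γ →
      Δ (ppart γ) ≈P ΠP (range1 N) (λ i → Δ (pp i (mult i γ))))
mainTheorem8 = (λ i r _ _ → coproduct-pp i r) , (λ γ _ → coproduct-ppart γ)
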